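{- For all integers $m\geq 2$ and $n\geq 1$, \[ |\mathrm{rSYT}(m,n)| \geq |\mathrm{rSYT}(m-1,n)| \left( \binom{n}{2} + 1 \right) .\] In particular, $|\mathrm{rSYT}(n,n)| \geq n^{4n-o(n)}$ as $n\to\infty$.
   Context: For positive integers $m,n$, an $m\times n$ (rectangular) standard Young tableau is a bijection $T:[m]\times[n]\to\{1,\dots,mn\}$ that is increasing along rows and columns: $T(i,j)<T(i,j+1)$ and $T(i,j)<T(i+1,j)$ whenever defined. A vector $x\in\mathbb{R}^k$ is increasing if $x_1<x_2<\dots<x_k$. For increasing $x\in\mathbb{R}^m$, $y\in\mathbb{R}^n$ such that the $mn$ numbers $x_i+y_j$ are pairwise distinct, let $\mathcal T(x\circ y)$ be the tableau whose $(i,j)$ entry is the rank of $x_i+y_j$ among these $mn$ numbers (rank $1$ = smallest). A tableau is realizable if it equals $\mathcal T(x\circ y)$ for some such $x,y$. $\mathrm{rSYT}(m,n)$ denotes the set of realizable $m\times n$ standard Young tableaux.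
   Formalization: The vectors x and y realizing a tableau as $\mathcal T(x\circ y)$ have entries in ℚ rather than ℝ. -}

module Defs where

open import Data.Nat as ℕ using (ℕ; suc; _≤_)
open import Data.Fin as Fin using (Fin)
open import Data.Vec using (Vec; lookup)
open import Data.List using (List; length; filter; allFin; cartesianProduct)
open import Data.List.Relation.Unary.Unique.Propositional using (Unique)
open import Data.List.Membership.Propositional using (_∈_)
open import Data.Product using (Σ; ∃; _×_; _,_; proj₁; proj₂)
open import Data.Rational as ℚ using (ℚ)
open import Relation.Binary.PropositionalEquality using (_≡_)

-- An m × n array of naturals, stored row by row (Vec of rows), so that
-- propositional equality is the right notion of equality of tableaux.
Tableau : ℕ → ℕ → Set
Tableau m n = Vec (Vec ℕ n) m

entry : ∀ {m n} → Tableau m n → Fin m → Fin n → ℕ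
entry T i j = lookup (lookup T i) j

record IsSYT {m n : ℕ} (T : Tableau m n) : Set where
  field
    inRange    : ∀ i j → 1 ≤ entry T i j × entry T i j ≤ m ℕ.* n
    injective  : ∀ i j k l → entry T i j ≡ entry T k l → (i ≡ k × j ≡ l)
    surjective : ∀ v → 1 ≤ v → v ≤ m ℕ.* n → ∃ λ i → ∃ λ j → entry T i j ≡ v
    rowIncr    : ∀ (i : Fin m) (j k : Fin n) → j Fin.< k → entry T i j ℕ.< entry T i k
    colIncr    : ∀ (i k : Fin m) (j : Fin n) → i Fin.< k → entry T i j ℕ.< entry T k j

Increasing : ∀ {k} → (Fin k → ℚ) → Set
Increasing {k} x = ∀ (i j : Fin k) → i Fin.< j → x i ℚ.< x j

DistinctSums : ∀ {m n} → (Fin m → ℚ) → (Fin n → ℚ) → Set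
DistinctSums {m} {n} x y =
  ∀ (i k : Fin m) (j l : Fin n) → x i ℚ.+ y j ≡ x k ℚ.+ y l → (i ≡ k × j ≡ l)

rank : ∀ {m n} → (Fin m → ℚ) → (Fin n → ℚ) → Fin m → Fin n → ℕ
rank {m} {n} x y i j =
  suc (length (filter (λ p → (x (proj₁ p) ℚ.+ y (proj₂ p)) ℚ.<? (x i ℚ.+ y j))
                      (cartesianProduct (allFin m) (allFin n))))

-- T = 𝒯(x ∘ y) for some admissible x, y (real numbers replaced by ℚ).
Realizable : ∀ {m n} → Tableau m n → Set
Realizable {m} {n} T =
  Σ (Fin m → ℚ) λ x → Σ (Fin n → ℚ) λ y →
    Increasing x × Increasing y × DistinctSums x y ×
    (∀ i j → entry T i j ≡ rank x y i j)

InRSYT : (m n : ℕ) → Tableau m n → Set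
InRSYT m n T = IsSYT T × Realizable T

HasSize : ∀ {A : Set} → (A → Set) → ℕ → Set
HasSize {A} P k =
  Σ (List A) λ L → Unique L × length L ≡ k × (∀ T → (T ∈ L → P T) × (P T → T ∈ L))

-- Let (x, y) realize an (m-1) × n tableau T.  Adding 2^j ε to y_j, for small ε, keeps T and makes
-- the differences y_l - y_j (j < l) pairwise distinct.  Now prepend a new smallest row x_0 - t with
-- t = v + η, where v is 0 or one of these C(n,2) differences and η lies below every gap between
-- the values of t at which two sums coincide.  Since t passing y_l - y_j reverses the order of
-- x_0 - t + y_l and x_0 + y_j, the C(n,2) + 1 choices give distinct m × n tableaux, and deleting
-- the new row and re-standardizing recovers T, so fibres over distinct T are disjoint.
-- Alternating this row extension with transposition gives |rSYT(n,n)| ≥ (n!)⁴ / (16ⁿ n²), and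
-- nⁿ ≤ 8ⁿ n! turns this into n^(4n - o(n)).
module Submission where

module Counting where

  open import Data.Nat using (ℕ; suc; _+_; _*_; _≤_; _<_; z≤n; s≤s; _≟_)
  open import Data.Nat.Properties using (≤-trans; ≤-reflexive; <-irrefl; m≤n⇒m≤1+n; module ≤-Reasoning)
  open import Data.List using (List; []; _∷_; _++_; length; filter; map; applyUpTo)
  open import Data.List.Properties using (length-++; length-++-sucʳ; length-map; filter-accept; filter-reject; filter-notAll; length-applyUpTo)
  open import Data.List.Relation.Unary.Unique.Propositional using (Unique; []; _∷_)
  import Data.List.Relation.Unary.Unique.Propositional.Properties as Unique
  open import Data.List.Relation.Unary.All as All using (All)
  open import Data.List.Relation.Unary.Any as Any using (here; there)
  open import Data.List.Membership.Propositional using (_∈_; find)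
  open import Data.List.Membership.Propositional.Properties using (∈-∃++; ∈-++⁻; ∈-++⁺ˡ; ∈-++⁺ʳ; ∈-map⁻; ∈-applyUpTo⁺)
  open import Data.List.Relation.Binary.Permutation.Propositional using (_↭_)
  open import Data.List.Relation.Binary.Permutation.Propositional.Properties using (↭-length; filter-↭)
  open import Data.Product using (Σ; _×_; _,_; proj₁; proj₂; uncurry)
  open import Data.Sum using (inj₁; inj₂)
  open import Data.Empty using (⊥; ⊥-elim)
  open import Relation.Nullary using (¬_; yes; no)
  open import Relation.Unary using (Decidable)
  open import Relation.Binary.PropositionalEquality using (_≡_; _≢_; refl; sym; trans; cong; subst)
  open import Defs using (HasSize)

  count : {A : Set} {P : A → Set} → Decidable P → List A → ℕ
  count P? xs = length (filter P? xs)

  module _ {A : Set} {P Q : A → Set} (P? : Decidable P) (Q? : Decidable Q) (P⇒Q : ∀ {a} → P a → Q a) where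

    count-mono : ∀ xs → count P? xs ≤ count Q? xs
    count-mono [] = z≤n
    count-mono (a ∷ xs) with P? a | Q? a
    ... | yes _  | yes _  = s≤s (count-mono xs)
    ... | yes pa | no ¬qa = ⊥-elim (¬qa (P⇒Q pa))
    ... | no _   | yes _  = m≤n⇒m≤1+n (count-mono xs)
    ... | no _   | no _   = count-mono xs

    count-mono-< : ∀ xs {b} → b ∈ xs → Q b → ¬ P b → count P? xs < count Q? xs
    count-mono-< (a ∷ xs) (here refl) qb ¬pb
      rewrite filter-reject P? {xs = xs} ¬pb | filter-accept Q? {xs = xs} qb = s≤s (count-mono xs)
    count-mono-< (a ∷ xs) (there b∈) qb ¬pb with P? a | Q? a
    ... | yes _  | yes _  = s≤s (count-mono-< xs b∈ qb ¬pb)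
    ... | yes pa | no ¬qa = ⊥-elim (¬qa (P⇒Q pa))
    ... | no _   | yes _  = m≤n⇒m≤1+n (count-mono-< xs b∈ qb ¬pb)
    ... | no _   | no _   = count-mono-< xs b∈ qb ¬pb

  module _ {A : Set} {P : A → Set} (P? : Decidable P) where

    count<length : ∀ xs {b} → b ∈ xs → ¬ P b → count P? xs < length xs
    count<length xs b∈ ¬pb = filter-notAll P? xs (Any.map (λ { refl → ¬pb }) b∈)

    count-↭ : ∀ {xs ys} → xs ↭ ys → count P? xs ≡ count P? ys
    count-↭ xs↭ys = ↭-length (filter-↭ P? xs↭ys)

  count-map : ∀ {A B : Set} {P : B → Set} (P? : Decidable P) (f : A → B) xs →
              count P? (map f xs) ≡ count (λ a → P? (f a)) xs
  count-map P? f [] = refl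
  count-map P? f (a ∷ xs) with P? (f a)
  ... | yes _ = cong suc (count-map P? f xs)
  ... | no _  = count-map P? f xs

  module _ {A : Set} where

    Unique-⊆⇒length≤ : ∀ {xs ys : List A} → Unique xs → (∀ {x} → x ∈ xs → x ∈ ys) → length xs ≤ length ys
    Unique-⊆⇒length≤ {[]} _ _ = z≤n
    Unique-⊆⇒length≤ {x ∷ xs} {ys} (x∉xs ∷ xs!) xs⊆ys with ∈-∃++ (xs⊆ys (here refl))
    ... | ys₁ , ys₂ , refl =
      ≤-trans (s≤s (Unique-⊆⇒length≤ xs! xs⊆ys₁++ys₂)) (≤-reflexive (sym (length-++-sucʳ ys₁ x ys₂)))
      where
      xs⊆ys₁++ys₂ : ∀ {z} → z ∈ xs → z ∈ ys₁ ++ ys₂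
      xs⊆ys₁++ys₂ {z} z∈xs with ∈-++⁻ ys₁ (xs⊆ys (there z∈xs))
      ... | inj₁ z∈ys₁         = ∈-++⁺ˡ z∈ys₁
      ... | inj₂ (here refl)   = ⊥-elim (All.lookup x∉xs z∈xs refl)
      ... | inj₂ (there z∈ys₂) = ∈-++⁺ʳ ys₁ z∈ys₂

    map⁺-injectiveOn : ∀ {B : Set} {f : A → B} {xs : List A} →
      (∀ {a b} → a ∈ xs → b ∈ xs → f a ≡ f b → a ≡ b) → Unique xs → Unique (map f xs)
    map⁺-injectiveOn {xs = []} inj [] = []
    map⁺-injectiveOn {f = f} {xs = x ∷ xs} inj (x∉xs ∷ xs!) =
      All.tabulate fx∉ ∷ map⁺-injectiveOn (λ a b → inj (there a) (there b)) xs!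
      where
      fx∉ : ∀ {z} → z ∈ map f xs → f x ≢ z
      fx∉ z∈ fx≡z with ∈-map⁻ f z∈
      ... | a , a∈xs , refl = All.lookup x∉xs a∈xs (inj (here refl) (there a∈xs) fx≡z)

  AtLeast : {A : Set} → (A → Set) → ℕ → Set
  AtLeast {A} P k = Σ (List A) λ L → Unique L × length L ≡ k × (∀ {a} → a ∈ L → P a)

  module _ {A : Set} {P : A → Set} where

    HasSize⇒AtLeast : ∀ {s} → HasSize P s → AtLeast P s
    HasSize⇒AtLeast (L , L! , |L|≡s , L↔P) = L , L! , |L|≡s , λ {a} a∈L → proj₁ (L↔P a) a∈L

    AtLeast-mono : ∀ {Q : A → Set} {k} → (∀ {a} → P a → Q a) → AtLeast P k → AtLeast Q k
    AtLeast-mono P⇒Q (L , L! , |L|≡k , L⊆P) = L , L! , |L|≡k , λ a∈L → P⇒Q (L⊆P a∈L)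

    AtLeast-≤-HasSize : ∀ {Q : A → Set} {k s} → AtLeast P k → (∀ {a} → P a → Q a) → HasSize Q s → k ≤ s
    AtLeast-≤-HasSize (L , L! , refl , L⊆P) P⇒Q (M , _ , refl , M↔Q) =
      Unique-⊆⇒length≤ L! (λ {a} a∈L → proj₂ (M↔Q a) (P⇒Q (L⊆P a∈L)))

    AtLeast-map : ∀ {B : Set} {Q : B → Set} {k} (f : A → B) → (∀ {a b} → f a ≡ f b → a ≡ b) →
                  (∀ {a} → P a → Q (f a)) → AtLeast P k → AtLeast Q k
    AtLeast-map {Q = Q} f f-inj P⇒Qf (L , L! , refl , L⊆P) =
      map f L , Unique.map⁺ f-inj L! , length-map f L , fL⊆Q
      where
      fL⊆Q : ∀ {b} → b ∈ map f L → Q b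
      fL⊆Q b∈ with ∈-map⁻ f b∈
      ... | a , a∈L , refl = P⇒Qf (L⊆P a∈L)

    module _ {B : Set} {Q : B → Set} {l} (r : B → A) (fibre : ∀ {a} → P a → AtLeast (λ b → Q b × r b ≡ a) l) where

      AtLeast-fibresOver : ∀ L → Unique L → (∀ {a} → a ∈ L → P a) → AtLeast (λ b → Q b × r b ∈ L) (length L * l)
      AtLeast-fibresOver [] _ _ = [] , [] , refl , λ ()
      AtLeast-fibresOver (a ∷ L) (a∉L ∷ L!) aL⊆P
        with fibre (aL⊆P (here refl)) | AtLeast-fibresOver L L! (λ a∈L → aL⊆P (there a∈L))
      ... | F , F! , refl , F⊆ | M , M! , |M| , M⊆ =
        F ++ M , Unique.++⁺ F! M! disjoint , trans (length-++ F) (cong (length F +_) |M|) , FM⊆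
        where
        disjoint : ∀ {b} → b ∈ F × b ∈ M → ⊥
        disjoint (b∈F , b∈M) = All.lookup a∉L (subst (_∈ L) (proj₂ (F⊆ b∈F)) (proj₂ (M⊆ b∈M))) refl
        FM⊆ : ∀ {b} → b ∈ F ++ M → Q b × r b ∈ a ∷ L
        FM⊆ b∈ with ∈-++⁻ F b∈
        ... | inj₁ b∈F = proj₁ (F⊆ b∈F) , here (proj₂ (F⊆ b∈F))
        ... | inj₂ b∈M = proj₁ (M⊆ b∈M) , there (proj₂ (M⊆ b∈M))

      AtLeast-fibres : ∀ {k} → AtLeast P k → AtLeast Q (k * l)
      AtLeast-fibres (L , L! , refl , L⊆P) =
        let M , M! , |M| , M⊆ = AtLeast-fibresOver L L! L⊆P in M , M! , |M| , λ b∈M → proj₁ (M⊆ b∈M)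

  injective⇒surjective-[1,N] : ∀ {A : Set} {f : A → ℕ} {xs : List A} → Unique xs →
    (∀ {a b} → f a ≡ f b → a ≡ b) → (∀ {a} → a ∈ xs → 1 ≤ f a × f a ≤ length xs) →
    ∀ {v} → 1 ≤ v → v ≤ length xs → Σ A λ a → a ∈ xs × f a ≡ v
  injective⇒surjective-[1,N] {f = f} {xs} xs! f-inj f∈[1,N] {v} 1≤v v≤N
    with Any.any? (λ a → f a ≟ v) xs
  ... | yes v∈fxs = find v∈fxs
  ... | no v∉fxs = ⊥-elim (<-irrefl refl too-many)
    where
    v∉ : ∀ {w} → w ∈ map f xs → v ≢ w
    v∉ w∈ refl with ∈-map⁻ f w∈
    ... | a , a∈xs , refl = v∉fxs (Any.map (λ { refl → refl }) a∈xs)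
    vfxs! : Unique (v ∷ map f xs)
    vfxs! = All.tabulate v∉ ∷ Unique.map⁺ f-inj xs!
    in-range : ∀ {w} → 1 ≤ w → w ≤ length xs → w ∈ applyUpTo suc (length xs)
    in-range {suc w} _ w<N = ∈-applyUpTo⁺ suc w<N
    vfxs⊆[1,N] : ∀ {w} → w ∈ v ∷ map f xs → w ∈ applyUpTo suc (length xs)
    vfxs⊆[1,N] (here refl) = in-range 1≤v v≤N
    vfxs⊆[1,N] (there w∈) with ∈-map⁻ f w∈
    ... | a , a∈xs , refl = uncurry in-range (f∈[1,N] a∈xs)
    too-many : suc (length xs) ≤ length xs
    too-many = begin
      suc (length xs)                     ≡⟨ cong suc (length-map f xs) ⟨
      length (v ∷ map f xs)               ≤⟨ Unique-⊆⇒length≤ vfxs! vfxs⊆[1,N] ⟩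
      length (applyUpTo suc (length xs))  ≡⟨ length-applyUpTo suc (length xs) ⟩
      length xs                           ∎
      where open ≤-Reasoning

module Grids where

  open import Data.Nat using (zero; suc; _+_; _*_; _<_; z≤n; s≤s)
  open import Data.Nat.Combinatorics using (_C_; nCk+nC[k+1]≡[n+1]C[k+1]; nC1≡n)
  open import Data.Fin using (Fin; toℕ)
  open import Data.List using (List; []; _∷_; _++_; length; map; cartesianProduct; allFin)
  open import Data.List.Properties using (length-++; length-map; length-tabulate)
  open import Data.List.Relation.Unary.Unique.Propositional using (Unique; [])
  import Data.List.Relation.Unary.Unique.Propositional.Properties as Unique
  open import Data.List.Membership.Propositional using (_∈_)
  open import Data.List.Membership.Propositional.Properties using (∈-cartesianProduct⁺; ∈-allFin; ∈-map⁺; ∈-map⁻; ∈-++⁻)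
  open import Data.List.Membership.Propositional.Properties.WithK using (unique∧set⇒bag)
  open import Data.List.Relation.Binary.BagAndSetEquality using (∼bag⇒↭)
  open import Data.List.Relation.Binary.Permutation.Propositional using (_↭_; ↭-sym)
  open import Data.Product using (_×_; _,_; proj₁; proj₂; swap)
  open import Data.Sum using (inj₁; inj₂)
  open import Data.Empty using (⊥)
  open import Function.Bundles using (mk⇔)
  open import Relation.Unary using (Decidable)
  open import Relation.Binary.PropositionalEquality using (_≡_; refl; sym; trans; cong; cong₂; module ≡-Reasoning)
  open Counting

  grid : ∀ m n → List (Fin m × Fin n)
  grid m n = cartesianProduct (allFin m) (allFin n)

  ∈-grid : ∀ {m n} (p : Fin m × Fin n) → p ∈ grid m n
  ∈-grid (i , j) = ∈-cartesianProduct⁺ (∈-allFin i) (∈-allFin j)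

  grid-unique : ∀ m n → Unique (grid m n)
  grid-unique m n = Unique.cartesianProduct⁺ (Unique.allFin⁺ m) (Unique.allFin⁺ n)

  length-cartesianProduct : ∀ {A B : Set} (xs : List A) (ys : List B) →
                            length (cartesianProduct xs ys) ≡ length xs * length ys
  length-cartesianProduct [] ys = refl
  length-cartesianProduct (x ∷ xs) ys =
    trans (length-++ (map (x ,_) ys)) (cong₂ _+_ (length-map (x ,_) ys) (length-cartesianProduct xs ys))

  length-grid : ∀ m n → length (grid m n) ≡ m * n
  length-grid m n = trans (length-cartesianProduct (allFin m) (allFin n))
                          (cong₂ _*_ (length-tabulate {n = m} (λ i → i)) (length-tabulate {n = n} (λ j → j)))

  count-grid-swap : ∀ {m n} {P : Fin m × Fin n → Set} (P? : Decidable P) →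
                    count P? (grid m n) ≡ count (λ q → P? (swap q)) (grid n m)
  count-grid-swap {m} {n} P? =
    trans (sym (count-map (λ q → P? (swap q)) swap (grid m n))) (count-↭ (λ q → P? (swap q)) (↭-sym grid↭swapped))
    where
    swapped-unique : Unique (map swap (grid m n))
    swapped-unique = Unique.map⁺ (cong swap) (grid-unique m n)
    grid↭swapped : grid n m ↭ map swap (grid m n)
    grid↭swapped = ∼bag⇒↭ (unique∧set⇒bag (grid-unique n m) swapped-unique
                     (mk⇔ (λ _ → ∈-map⁺ swap (∈-grid _)) (λ _ → ∈-grid _)))

  pairsWithZero : ∀ n → List (Fin (suc n) × Fin (suc n))
  pairsWithZero n = map (λ l → Fin.zero , Fin.suc l) (allFin n)

  sucPair : ∀ {n} → Fin n × Fin n → Fin (suc n) × Fin (suc n)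
  sucPair (j , l) = Fin.suc j , Fin.suc l

  increasingPairs : ∀ n → List (Fin n × Fin n)
  increasingPairs zero = []
  increasingPairs (suc n) = pairsWithZero n ++ map sucPair (increasingPairs n)

  increasingPairs-< : ∀ n {p} → p ∈ increasingPairs n → toℕ (proj₁ p) < toℕ (proj₂ p)
  increasingPairs-< (suc n) p∈ with ∈-++⁻ (pairsWithZero n) p∈
  ... | inj₁ p∈first with ∈-map⁻ _ p∈first
  ...   | _ , _ , refl = s≤s z≤n
  increasingPairs-< (suc n) p∈ | inj₂ p∈rest with ∈-map⁻ sucPair p∈rest
  ...   | _ , q∈ , refl = s≤s (increasingPairs-< n q∈)

  [1+n]C2≡n+nC2 : ∀ n → suc n C 2 ≡ n + n C 2
  [1+n]C2≡n+nC2 n = trans (sym (nCk+nC[k+1]≡[n+1]C[k+1] n 1)) (cong (_+ n C 2) (nC1≡n n))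

  length-increasingPairs : ∀ n → length (increasingPairs n) ≡ n C 2
  length-increasingPairs zero = refl
  length-increasingPairs (suc n) = begin
    length (pairsWithZero n ++ map sucPair (increasingPairs n))     ≡⟨ length-++ (pairsWithZero n) ⟩
    length (pairsWithZero n) + length (map sucPair (increasingPairs n))
      ≡⟨ cong₂ _+_ (trans (length-map _ (allFin n)) (length-tabulate {n = n} (λ i → i)))
                   (trans (length-map sucPair (increasingPairs n)) (length-increasingPairs n)) ⟩
    n + n C 2                                                       ≡⟨ [1+n]C2≡n+nC2 n ⟨
    suc n C 2                                                       ∎
    where open ≡-Reasoning

  increasingPairs-unique : ∀ n → Unique (increasingPairs n)
  increasingPairs-unique zero = []
  increasingPairs-unique (suc n) =
    Unique.++⁺ (Unique.map⁺ (λ { refl → refl }) (Unique.allFin⁺ n))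
               (Unique.map⁺ (λ { {_ , _} {_ , _} refl → refl }) (increasingPairs-unique n))
               disjoint
    where
    disjoint : ∀ {p} → p ∈ pairsWithZero n × p ∈ map sucPair (increasingPairs n) → ⊥
    disjoint (p∈first , p∈rest) with ∈-map⁻ _ p∈first | ∈-map⁻ sucPair p∈rest
    ... | _ , _ , refl | (_ , _) , _ , ()

module Ranks where

  open import Defs
  open import Data.Nat as ℕ using (ℕ; suc; _*_; z≤n; s≤s)
  import Data.Nat.Properties as ℕₚ
  open import Data.Fin using (Fin; toℕ)
  open import Data.Fin.Properties using (toℕ-injective)
  open import Data.Vec using (Vec; lookup; tabulate)
  open import Data.Vec.Properties using (lookup∘tabulate; tabulate∘lookup; tabulate-cong)
  open import Data.List using (length)
  open import Data.List.Membership.Propositional using (_∈_)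
  open import Data.List.Properties using (filter-≐)
  open import Data.Product using (∃₂; _×_; _,_; proj₁; proj₂; swap)
  open import Data.Empty using (⊥-elim)
  open import Data.Rational using (ℚ; _+_; _<_; _<?_)
  open import Data.Rational.Properties using (<-cmp; <-trans; <-irrefl; <-asym; +-comm; +-monoʳ-<; +-monoˡ-<)
  open import Relation.Binary using (tri<; tri≈; tri>)
  open import Relation.Binary.PropositionalEquality using (_≡_; refl; sym; trans; cong; subst; subst₂)
  open Counting
  open Grids

  entry-tabulate : ∀ {m n} (f : Fin m → Fin n → ℕ) i j → entry (tabulate λ i → tabulate (f i)) i j ≡ f i j
  entry-tabulate f i j = trans (cong (λ row → lookup row j) (lookup∘tabulate (λ i → tabulate (f i)) i))
                               (lookup∘tabulate (f i) j)

  lookup-ext : ∀ {A : Set} {n} {u v : Vec A n} → (∀ i → lookup u i ≡ lookup v i) → u ≡ v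
  lookup-ext {u = u} {v} u≗v = trans (sym (tabulate∘lookup u)) (trans (tabulate-cong u≗v) (tabulate∘lookup v))

  Tableau-ext : ∀ {m n} {A B : Tableau m n} → (∀ i j → entry A i j ≡ entry B i j) → A ≡ B
  Tableau-ext A≗B = lookup-ext λ i → lookup-ext (A≗B i)

  Admissible : ∀ {m n} → (Fin m → ℚ) → (Fin n → ℚ) → Set
  Admissible x y = Increasing x × Increasing y × DistinctSums x y

  Increasing-injective : ∀ {k} {y : Fin k → ℚ} → Increasing y → ∀ {j l} → y j ≡ y l → j ≡ l
  Increasing-injective y↑ {j} {l} yj≡yl with ℕₚ.<-cmp (toℕ j) (toℕ l)
  ... | tri< j<l _ _ = ⊥-elim (<-irrefl yj≡yl (y↑ j l j<l))
  ... | tri≈ _ j≡l _ = toℕ-injective j≡l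
  ... | tri> _ _ j>l = ⊥-elim (<-irrefl (sym yj≡yl) (y↑ l j j>l))

  tableau : ∀ {m n} → (Fin m → ℚ) → (Fin n → ℚ) → Tableau m n
  tableau x y = tabulate λ i → tabulate λ j → rank x y i j

  entry-tableau : ∀ {m n} (x : Fin m → ℚ) (y : Fin n → ℚ) i j → entry (tableau x y) i j ≡ rank x y i j
  entry-tableau x y = entry-tabulate (rank x y)

  module _ {m n} (x : Fin m → ℚ) (y : Fin n → ℚ) where

    rank-mono-< : ∀ {i j k l} → x i + y j < x k + y l → rank x y i j ℕ.< rank x y k l
    rank-mono-< {i} {j} {k} {l} sum< =
      s≤s (count-mono-< (λ p → x (proj₁ p) + y (proj₂ p) <? x i + y j) (λ p → x (proj₁ p) + y (proj₂ p) <? x k + y l)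
                        (λ below → <-trans below sum<) (grid m n) (∈-grid (i , j)) sum< (<-irrefl refl))

    rank≤m*n : ∀ i j → rank x y i j ℕ.≤ m * n
    rank≤m*n i j = subst (rank x y i j ℕ.≤_) (length-grid m n)
      (count<length (λ p → x (proj₁ p) + y (proj₂ p) <? x i + y j) (grid m n) (∈-grid (i , j)) (<-irrefl refl))

    module _ (distinct : DistinctSums x y) where

      rank-injective : ∀ {i j k l} → rank x y i j ≡ rank x y k l → i ≡ k × j ≡ l
      rank-injective {i} {j} {k} {l} rank≡ with <-cmp (x i + y j) (x k + y l)
      ... | tri< sum< _ _ = ⊥-elim (ℕₚ.<-irrefl rank≡ (rank-mono-< sum<))
      ... | tri≈ _ sum≡ _ = distinct i k j l sum≡
      ... | tri> _ _ sum> = ⊥-elim (ℕₚ.<-irrefl (sym rank≡) (rank-mono-< sum>))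

      rank-cancel-< : ∀ {i j k l} → rank x y i j ℕ.< rank x y k l → x i + y j < x k + y l
      rank-cancel-< {i} {j} {k} {l} rank< with <-cmp (x i + y j) (x k + y l)
      ... | tri< sum< _ _ = sum<
      ... | tri≈ _ sum≡ _ with refl , refl ← distinct i k j l sum≡ = ⊥-elim (ℕₚ.<-irrefl refl rank<)
      ... | tri> _ _ sum> = ⊥-elim (ℕₚ.<-asym rank< (rank-mono-< sum>))

      rank-surjective : ∀ v → 1 ℕ.≤ v → v ℕ.≤ m * n → ∃₂ λ i j → rank x y i j ≡ v
      rank-surjective v 1≤v v≤mn =
        let (i , j) , _ , rank≡v = injective⇒surjective-[1,N] (grid-unique m n) injective in-range 1≤v
                                     (subst (v ℕ.≤_) (sym (length-grid m n)) v≤mn)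
        in i , j , rank≡v
        where
        rankAt : Fin m × Fin n → ℕ
        rankAt (i , j) = rank x y i j
        injective : ∀ {p q} → rankAt p ≡ rankAt q → p ≡ q
        injective rank≡ with refl , refl ← rank-injective rank≡ = refl
        in-range : ∀ {p} → p ∈ grid m n → 1 ℕ.≤ rankAt p × rankAt p ℕ.≤ length (grid m n)
        in-range {i , j} _ = s≤s z≤n , subst (rank x y i j ℕ.≤_) (sym (length-grid m n)) (rank≤m*n i j)

  tableau-mono-< : ∀ {m n} (x : Fin m → ℚ) (y : Fin n → ℚ) i j k l →
                   x i + y j < x k + y l → entry (tableau x y) i j ℕ.< entry (tableau x y) k l
  tableau-mono-< x y i j k l sum< =
    subst₂ ℕ._<_ (sym (entry-tableau x y i j)) (sym (entry-tableau x y k l)) (rank-mono-< x y {i} {j} {k} {l} sum<)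

  tableau-cancel-< : ∀ {m n} (x : Fin m → ℚ) (y : Fin n → ℚ) → DistinctSums x y → ∀ i j k l →
                     entry (tableau x y) i j ℕ.< entry (tableau x y) k l → x i + y j < x k + y l
  tableau-cancel-< x y distinct i j k l entry< =
    rank-cancel-< x y distinct {i} {j} {k} {l} (subst₂ ℕ._<_ (entry-tableau x y i j) (entry-tableau x y k l) entry<)

  tableau-isSYT : ∀ {m n} {x : Fin m → ℚ} {y : Fin n → ℚ} → Admissible x y → IsSYT (tableau x y)
  tableau-isSYT {m} {n} {x} {y} (x↑ , y↑ , distinct) = record
    { inRange    = λ i j → subst (λ r → 1 ℕ.≤ r × r ℕ.≤ m * n) (sym (entry-tableau x y i j)) (s≤s z≤n , rank≤m*n x y i j)
    ; injective  = λ i j k l entry≡ → rank-injective x y distinct (via-entries entry≡)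
    ; surjective = λ v 1≤v v≤mn → let i , j , rank≡v = rank-surjective x y distinct v 1≤v v≤mn
                                  in i , j , trans (entry-tableau x y i j) rank≡v
    ; rowIncr    = λ i j k j<k → tableau-mono-< x y i j i k (+-monoʳ-< (x i) (y↑ j k j<k))
    ; colIncr    = λ i k j i<k → tableau-mono-< x y i j k j (+-monoˡ-< (y j) (x↑ i k i<k))
    }
    where
    via-entries : ∀ {i j k l} → entry (tableau x y) i j ≡ entry (tableau x y) k l → rank x y i j ≡ rank x y k l
    via-entries {i} {j} {k} {l} entry≡ = trans (sym (entry-tableau x y i j)) (trans entry≡ (entry-tableau x y k l))

  tableau-realizable : ∀ {m n} {x : Fin m → ℚ} {y : Fin n → ℚ} → Admissible x y → Realizable (tableau x y)
  tableau-realizable {x = x} {y} (x↑ , y↑ , distinct) = x , y , x↑ , y↑ , distinct , entry-tableau x y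

  Realizable⇒≡tableau : ∀ {m n} {T : Tableau m n} ((x , y , _) : Realizable T) → T ≡ tableau x y
  Realizable⇒≡tableau (x , y , _ , _ , _ , T≗rank) = Tableau-ext λ i j → trans (T≗rank i j) (sym (entry-tableau x y i j))

  Realizable⇒InRSYT : ∀ {m n} {T : Tableau m n} → Realizable T → InRSYT m n T
  Realizable⇒InRSYT T-real@(x , y , x↑ , y↑ , distinct , _) =
    subst IsSYT (sym (Realizable⇒≡tableau T-real)) (tableau-isSYT (x↑ , y↑ , distinct)) , T-real

  DistinctSums-resp-< : ∀ {m n} {x x′ : Fin m → ℚ} {y y′ : Fin n → ℚ} → DistinctSums x y →
                        (∀ i j k l → x i + y j < x k + y l → x′ i + y′ j < x′ k + y′ l) → DistinctSums x′ y′
  DistinctSums-resp-< {x = x} {y = y} distinct order i k j l sum′≡ with <-cmp (x i + y j) (x k + y l)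
  ... | tri< sum< _ _ = ⊥-elim (<-irrefl sum′≡ (order i j k l sum<))
  ... | tri≈ _ sum≡ _ = distinct i k j l sum≡
  ... | tri> _ _ sum> = ⊥-elim (<-irrefl (sym sum′≡) (order k l i j sum>))

  rank-cong-< : ∀ {m n} {x x′ : Fin m → ℚ} {y y′ : Fin n → ℚ} → DistinctSums x y →
                (∀ i j k l → x i + y j < x k + y l → x′ i + y′ j < x′ k + y′ l) →
                ∀ i j → rank x′ y′ i j ≡ rank x y i j
  rank-cong-< {m} {n} {x} {x′} {y} {y′} distinct order i j =
    cong (λ ps → suc (length ps)) (filter-≐ (λ p → x′ (proj₁ p) + y′ (proj₂ p) <? x′ i + y′ j)
                                             (λ p → x (proj₁ p) + y (proj₂ p) <? x i + y j)
                                             (reflect , λ {p} → order (proj₁ p) (proj₂ p) i j) (grid m n))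
    where
    reflect : ∀ {p} → x′ (proj₁ p) + y′ (proj₂ p) < x′ i + y′ j → x (proj₁ p) + y (proj₂ p) < x i + y j
    reflect {k , l} sum′< with <-cmp (x k + y l) (x i + y j)
    ... | tri< sum< _ _ = sum<
    ... | tri≈ _ sum≡ _ with refl , refl ← distinct k i l j sum≡ = ⊥-elim (<-irrefl refl sum′<)
    ... | tri> _ _ sum> = ⊥-elim (<-asym sum′< (order i j k l sum>))

  transpose : ∀ {m n} → Tableau m n → Tableau n m
  transpose T = tabulate λ j → tabulate λ i → entry T i j

  entry-transpose : ∀ {m n} (T : Tableau m n) i j → entry (transpose T) j i ≡ entry T i j
  entry-transpose T i j = entry-tabulate (λ j i → entry T i j) j i

  transpose-injective : ∀ {m n} {A B : Tableau m n} → transpose A ≡ transpose B → A ≡ B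
  transpose-injective {A = A} {B} Aᵀ≡Bᵀ = Tableau-ext λ i j →
    trans (sym (entry-transpose A i j)) (trans (cong (λ T → entry T j i) Aᵀ≡Bᵀ) (entry-transpose B i j))

  rank-swap : ∀ {m n} (x : Fin m → ℚ) (y : Fin n → ℚ) i j → rank y x j i ≡ rank x y i j
  rank-swap {m} {n} x y i j = cong suc (begin
    count (λ q → y (proj₁ q) + x (proj₂ q) <? y j + x i) (grid n m)
      ≡⟨ cong length (filter-≐ _ _ (commute-yx , commute-xy) (grid n m)) ⟩
    count (λ q → x (proj₂ q) + y (proj₁ q) <? x i + y j) (grid n m)
      ≡⟨ count-grid-swap (λ p → x (proj₁ p) + y (proj₂ p) <? x i + y j) ⟨
    count (λ p → x (proj₁ p) + y (proj₂ p) <? x i + y j) (grid m n) ∎)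
    where
    open Relation.Binary.PropositionalEquality.≡-Reasoning
    commute-yx : ∀ {q} → y (proj₁ q) + x (proj₂ q) < y j + x i → x (proj₂ q) + y (proj₁ q) < x i + y j
    commute-yx {l , k} = subst₂ _<_ (+-comm (y l) (x k)) (+-comm (y j) (x i))
    commute-xy : ∀ {q} → x (proj₂ q) + y (proj₁ q) < x i + y j → y (proj₁ q) + x (proj₂ q) < y j + x i
    commute-xy {l , k} = subst₂ _<_ (+-comm (x k) (y l)) (+-comm (x i) (y j))

  Realizable-transpose : ∀ {m n} {T : Tableau m n} → Realizable T → Realizable (transpose T)
  Realizable-transpose {T = T} (x , y , x↑ , y↑ , distinct , T≗rank) =
    y , x , y↑ , x↑ , distinct′ , λ j i → trans (entry-transpose T i j) (trans (T≗rank i j) (sym (rank-swap x y i j)))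
    where
    distinct′ : DistinctSums y x
    distinct′ j l i k sum≡ = swap (distinct i k j l (trans (+-comm (x i) (y j)) (trans sum≡ (+-comm (y l) (x k)))))

module RationalGaps where

  open import Data.Nat as ℕ using (ℕ; zero; suc; z≤n; s≤s)
  import Data.Nat.Properties as ℕₚ
  open import Data.Rational using (ℚ; _+_; _-_; -_; _*_; 0ℚ; 1ℚ; ½; _<_; _≤_; _<?_; _⊓_)
  open import Data.Rational.Properties
  open import Data.Rational.Solver using (module +-*-Solver)
  open import Algebra.Properties.Monoid.Mult +-0-monoid using () renaming (_×_ to _·_)
  open import Data.List using (List; []; _∷_; cartesianProduct)
  open import Data.List.Relation.Unary.Any using (here; there)
  open import Data.List.Membership.Propositional using (_∈_)
  open import Data.List.Membership.Propositional.Properties using (∈-cartesianProduct⁺)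
  open import Data.Product using (∃; _×_; _,_)
  open import Data.Sum using (inj₁; inj₂)
  open import Data.Empty using (⊥-elim)
  open import Relation.Nullary using (yes; no)
  open import Relation.Binary using (tri<; tri≈; tri>)
  open import Relation.Binary.PropositionalEquality using (_≡_; refl; sym; trans; cong; subst; subst₂)
  open +-*-Solver

  p<p+q : ∀ {p q} → 0ℚ < q → p < p + q
  p<p+q {p} 0<q = subst (_< p + _) (+-identityʳ p) (+-monoʳ-< p 0<q)

  p≤p+q : ∀ {p q} → 0ℚ ≤ q → p ≤ p + q
  p≤p+q {p} 0≤q = subst (_≤ p + _) (+-identityʳ p) (+-monoʳ-≤ p 0≤q)

  p+q<p : ∀ {p q} → q < 0ℚ → p + q < p
  p+q<p {p} q<0 = subst (p + _ <_) (+-identityʳ p) (+-monoʳ-< p q<0)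

  p≤q+p : ∀ {p q} → 0ℚ ≤ q → p ≤ q + p
  p≤q+p {p} {q} 0≤q = subst (p ≤_) (+-comm p q) (p≤p+q 0≤q)

  p-q<p : ∀ {p q} → 0ℚ < q → p - q < p
  p-q<p 0<q = p+q<p (neg-antimono-< 0<q)

  0<q-p : ∀ {p q} → p < q → 0ℚ < q - p
  0<q-p {p} {q} p<q = subst (_< q - p) (+-inverseʳ p) (+-monoˡ-< (- p) p<q)

  p-q<0 : ∀ {p q} → p < q → p - q < 0ℚ
  p-q<0 {p} {q} p<q = subst (p - q <_) (+-inverseʳ q) (+-monoˡ-< (- q) p<q)

  ·-nonNeg : ∀ {ε} k → 0ℚ ≤ ε → 0ℚ ≤ k · ε
  ·-nonNeg zero    0≤ε = ≤-refl
  ·-nonNeg {ε} (suc k) 0≤ε = subst (_≤ ε + k · ε) (+-identityˡ 0ℚ) (+-mono-≤ 0≤ε (·-nonNeg k 0≤ε))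

  ·-monoˡ-≤ : ∀ {ε a b} → 0ℚ ≤ ε → a ℕ.≤ b → a · ε ≤ b · ε
  ·-monoˡ-≤ {b = b} 0≤ε z≤n     = ·-nonNeg b 0≤ε
  ·-monoˡ-≤ {ε}     0≤ε (s≤s a≤b) = +-monoʳ-≤ ε (·-monoˡ-≤ 0≤ε a≤b)

  ·-monoˡ-< : ∀ {ε a b} → 0ℚ < ε → a ℕ.< b → a · ε < b · ε
  ·-monoˡ-< {ε} {b = suc b} 0<ε (s≤s z≤n) = subst (_< ε + b · ε) (+-identityˡ 0ℚ) (+-mono-<-≤ 0<ε (·-nonNeg b (<⇒≤ 0<ε)))
  ·-monoˡ-< {ε} 0<ε (s≤s (s≤s a<b)) = +-monoʳ-< ε (·-monoˡ-< 0<ε (s≤s a<b))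

  ·-cancelʳ : ∀ {ε a b} → 0ℚ < ε → a · ε ≡ b · ε → a ≡ b
  ·-cancelʳ {a = a} {b} 0<ε aε≡bε with ℕₚ.<-cmp a b
  ... | tri< a<b _ _ = ⊥-elim (<-irrefl aε≡bε (·-monoˡ-< 0<ε a<b))
  ... | tri≈ _ a≡b _ = a≡b
  ... | tri> _ _ a>b = ⊥-elim (<-irrefl (sym aε≡bε) (·-monoˡ-< 0<ε a>b))

  half : ℚ → ℚ
  half η = η * ½

  half+half : ∀ η → half η + half η ≡ η
  half+half η = trans (sym (*-distribˡ-+ η ½ ½)) (*-identityʳ η)

  0<half : ∀ {η} → 0ℚ < η → 0ℚ < half η
  0<half {η} 0<η = subst (_< half η) (*-zeroˡ ½) (*-monoˡ-<-pos ½ 0<η)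

  half< : ∀ {η} → 0ℚ < η → half η < η
  half< {η} 0<η = subst₂ _<_ (+-identityʳ (half η)) (half+half η) (+-monoʳ-< (half η) (0<half 0<η))

  smallMultiple : ∀ M {η} → 0ℚ < η → ∃ λ ε → 0ℚ < ε × ε < η × M · ε < η
  smallMultiple zero    {η} 0<η = half η , 0<half 0<η , half< 0<η , 0<η
  smallMultiple (suc M) {η} 0<η with smallMultiple M (0<half 0<η)
  ... | ε , 0<ε , ε<η/2 , Mε<η/2 =
    ε , 0<ε , <-trans ε<η/2 (half< 0<η) , subst (_ <_) (half+half η) (+-mono-< ε<η/2 Mε<η/2)

  pairsGap : ∀ ps → ∃ λ η → 0ℚ < η × (∀ {a b} → (a , b) ∈ ps → a < b → a + η < b)
  pairsGap [] = 1ℚ , positive⁻¹ 1ℚ , λ ()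
  pairsGap ((a , b) ∷ ps) with pairsGap ps | a <? b
  ... | η , 0<η , gap | no a≮b = η , 0<η , λ { (here refl) a<b → ⊥-elim (a≮b a<b) ; (there ab∈) → gap ab∈ }
  ... | η , 0<η , gap | yes a<b with <-dense a<b
  ...   | r , a<r , r<b = η ⊓ (r - a) , 0<min , gap′
    where
    0<min : 0ℚ < η ⊓ (r - a)
    0<min with ⊓-sel η (r - a)
    ... | inj₁ min≡η = subst (0ℚ <_) (sym min≡η) 0<η
    ... | inj₂ min≡r-a = subst (0ℚ <_) (sym min≡r-a) (0<q-p a<r)
    a+[r-a]≡r : a + (r - a) ≡ r
    a+[r-a]≡r = solve 2 (λ a r → a :+ (r :- a) := r) refl a r
    gap′ : ∀ {a′ b′} → (a′ , b′) ∈ (a , b) ∷ ps → a′ < b′ → a′ + η ⊓ (r - a) < b′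
    gap′ (here refl) _ = ≤-<-trans (+-monoʳ-≤ a (p⊓q≤q η (r - a))) (subst (_< b) (sym a+[r-a]≡r) r<b)
    gap′ {a′} (there ab∈) a′<b′ = ≤-<-trans (+-monoʳ-≤ a′ (p⊓q≤p η (r - a))) (gap ab∈ a′<b′)

  uniformGap : ∀ (L : List ℚ) → ∃ λ η → 0ℚ < η × (∀ {a b} → a ∈ L → b ∈ L → a < b → a + η < b)
  uniformGap L with pairsGap (cartesianProduct L L)
  ... | η , 0<η , gap = η , 0<η , λ a∈ b∈ → gap (∈-cartesianProduct⁺ a∈ b∈)

  p-q≡r-s⇒p+s≡r+q : ∀ {p q r s} → p - q ≡ r - s → p + s ≡ r + q
  p-q≡r-s⇒p+s≡r+q {p} {q} {r} {s} p-q≡r-s = begin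
    p + s              ≡⟨ solve 3 (λ p q s → p :+ s := (p :- q) :+ (q :+ s)) refl p q s ⟩
    (p - q) + (q + s)  ≡⟨ cong (_+ (q + s)) p-q≡r-s ⟩
    (r - s) + (q + s)  ≡⟨ solve 3 (λ q r s → (r :- s) :+ (q :+ s) := r :+ q) refl q r s ⟩
    r + q              ∎
    where open Relation.Binary.PropositionalEquality.≡-Reasoning

module GenericPosition where

  open import Defs
  open import Data.Nat as ℕ using (ℕ; suc; _^_; z≤n; s≤s)
  import Data.Nat.Properties as ℕₚ
  open import Data.Fin as Fin using (Fin; toℕ)
  open import Data.Fin.Properties using (toℕ-injective; toℕ<n)
  open import Data.List using (List; _++_; map)
  open import Data.List.Membership.Propositional using (_∈_)
  open import Data.List.Membership.Propositional.Properties using (∈-map⁺; ∈-++⁺ˡ; ∈-++⁺ʳ)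
  open import Data.Product using (Σ; _×_; _,_; proj₁; proj₂)
  open import Data.Empty using (⊥-elim)
  open import Data.Rational using (ℚ; _+_; _<_; 0ℚ)
  open import Data.Rational.Properties
  open import Data.Rational.Solver using (module +-*-Solver)
  open import Algebra.Properties.Monoid.Mult +-0-monoid using (×-homo-+) renaming (_×_ to _·_)
  open import Algebra.Properties.Group +-0-group using () renaming (∙-cancelˡ to +-cancelˡ)
  open import Relation.Binary using (tri<; tri≈; tri>)
  open import Relation.Binary.PropositionalEquality using (_≡_; refl; sym; trans; cong; subst₂; module ≡-Reasoning)
  open Grids
  open Ranks
  open RationalGaps

  2^a+2^b≤2^c : ∀ {a b c} → a ℕ.< c → b ℕ.< c → 2 ^ a ℕ.+ 2 ^ b ℕ.≤ 2 ^ c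
  2^a+2^b≤2^c {a} {b} {suc c} (s≤s a≤c) (s≤s b≤c) =
    ℕₚ.≤-trans (ℕₚ.+-mono-≤ (ℕₚ.^-monoʳ-≤ 2 a≤c) (ℕₚ.^-monoʳ-≤ 2 b≤c))
               (ℕₚ.≤-reflexive (cong (2 ^ c ℕ.+_) (sym (ℕₚ.+-identityʳ (2 ^ c)))))

  2^-injective : ∀ {a b} → 2 ^ a ≡ 2 ^ b → a ≡ b
  2^-injective {a} {b} 2^a≡2^b with ℕₚ.<-cmp a b
  ... | tri< a<b _ _ = ⊥-elim (ℕₚ.<-irrefl 2^a≡2^b (ℕₚ.^-monoʳ-< 2 (s≤s (s≤s z≤n)) a<b))
  ... | tri≈ _ a≡b _ = a≡b
  ... | tri> _ _ a>b = ⊥-elim (ℕₚ.<-irrefl (sym 2^a≡2^b) (ℕₚ.^-monoʳ-< 2 (s≤s (s≤s z≤n)) a>b))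

  -- In  2^l + 2^j′ = 2^j + 2^l′  the side with the larger top exponent is strictly larger.
  2^-distinctDifferences : ∀ {j l j′ l′} → j ℕ.< l → j′ ℕ.< l′ → 2 ^ l ℕ.+ 2 ^ j′ ≡ 2 ^ j ℕ.+ 2 ^ l′ → j ≡ j′ × l ≡ l′
  2^-distinctDifferences {j} {l} {j′} {l′} j<l j′<l′ sums≡ with ℕₚ.<-cmp l l′
  ... | tri< l<l′ _ _ =
    ⊥-elim (ℕₚ.<-irrefl sums≡ (ℕₚ.≤-<-trans (2^a+2^b≤2^c l<l′ j′<l′) (ℕₚ.m<n+m (2 ^ l′) (ℕₚ.m^n>0 2 j))))
  ... | tri> _ _ l>l′ =
    ⊥-elim (ℕₚ.<-irrefl (sym sums≡) (ℕₚ.≤-<-trans (2^a+2^b≤2^c j<l l>l′) (ℕₚ.m<m+n (2 ^ l) (ℕₚ.m^n>0 2 j′))))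
  ... | tri≈ _ refl _ =
    2^-injective (sym (ℕₚ.+-cancelˡ-≡ (2 ^ l) (2 ^ j′) (2 ^ j) (trans sums≡ (ℕₚ.+-comm (2 ^ j) (2 ^ l))))) , refl

  DistinctDifferences : ∀ {n} → (Fin n → ℚ) → Set
  DistinctDifferences y = ∀ {j l j′ l′} → j Fin.< l → j′ Fin.< l′ → y l + y j′ ≡ y j + y l′ → j ≡ j′ × l ≡ l′

  sumsOf : ∀ {m n} → (Fin m → ℚ) → (Fin n → ℚ) → List ℚ
  sumsOf {m} {n} x y = map (λ p → x (proj₁ p) + y (proj₂ p)) (grid m n)

  ∈-sumsOf : ∀ {m n} (x : Fin m → ℚ) (y : Fin n → ℚ) i j → x i + y j ∈ sumsOf x y
  ∈-sumsOf x y i j = ∈-map⁺ (λ p → x (proj₁ p) + y (proj₂ p)) (∈-grid (i , j))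

  module Perturbation {m n} (x : Fin m → ℚ) (y : Fin n → ℚ) where

    open +-*-Solver

    sums : List ℚ
    sums = sumsOf x y ++ sumsOf y y

    η : ℚ
    η = proj₁ (uniformGap sums)
    0<η : 0ℚ < η
    0<η = proj₁ (proj₂ (uniformGap sums))

    K : ℕ
    K = 2 ^ n ℕ.+ 2 ^ n

    ε : ℚ
    ε = proj₁ (smallMultiple K 0<η)
    0<ε : 0ℚ < ε
    0<ε = proj₁ (proj₂ (smallMultiple K 0<η))

    weight : Fin n → ℕ
    weight j = 2 ^ toℕ j

    weight≤2^n : ∀ j → weight j ℕ.≤ 2 ^ n
    weight≤2^n j = ℕₚ.^-monoʳ-≤ 2 (ℕₚ.<⇒≤ (toℕ<n j))

    weight+weight≤K : ∀ j l → weight j ℕ.+ weight l ℕ.≤ K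
    weight+weight≤K j l = ℕₚ.+-mono-≤ (weight≤2^n j) (weight≤2^n l)

    y′ : Fin n → ℚ
    y′ j = y j + weight j · ε

    perturbed-< : ∀ {A B} u v → A ∈ sums → B ∈ sums → A < B → u ℕ.≤ K → A + u · ε < B + v · ε
    perturbed-< {A} {B} u v A∈ B∈ A<B u≤K = begin-strict
      A + u · ε  ≤⟨ +-monoʳ-≤ A (·-monoˡ-≤ (<⇒≤ 0<ε) u≤K) ⟩
      A + K · ε  <⟨ +-monoʳ-< A (proj₂ (proj₂ (proj₂ (smallMultiple K 0<η)))) ⟩
      A + η      <⟨ proj₂ (proj₂ (uniformGap sums)) A∈ B∈ A<B ⟩
      B          ≤⟨ p≤p+q (·-nonNeg v (<⇒≤ 0<ε)) ⟩
      B + v · ε  ∎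
      where open ≤-Reasoning

    x+y′ : ∀ i j → x i + y′ j ≡ (x i + y j) + weight j · ε
    x+y′ i j = solve 3 (λ a b e → a :+ (b :+ e) := (a :+ b) :+ e) refl (x i) (y j) (weight j · ε)

    y′+y′ : ∀ j l → y′ j + y′ l ≡ (y j + y l) + (weight j ℕ.+ weight l) · ε
    y′+y′ j l = begin
      (y j + weight j · ε) + (y l + weight l · ε)  ≡⟨ solve 4 (λ a u b v → (a :+ u) :+ (b :+ v) := (a :+ b) :+ (u :+ v))
                                                              refl (y j) (weight j · ε) (y l) (weight l · ε) ⟩
      (y j + y l) + (weight j · ε + weight l · ε)  ≡⟨ cong ((y j + y l) +_) (×-homo-+ ε (weight j) (weight l)) ⟨
      (y j + y l) + (weight j ℕ.+ weight l) · ε    ∎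
      where open ≡-Reasoning

    xy-order : ∀ i j k l → x i + y j < x k + y l → x i + y′ j < x k + y′ l
    xy-order i j k l sum< = subst₂ _<_ (sym (x+y′ i j)) (sym (x+y′ k l))
      (perturbed-< (weight j) (weight l) (∈-++⁺ˡ (∈-sumsOf x y i j)) (∈-++⁺ˡ (∈-sumsOf x y k l)) sum<
                   (ℕₚ.≤-trans (weight≤2^n j) (ℕₚ.m≤m+n (2 ^ n) (2 ^ n))))

    yy-order : ∀ j l j′ l′ → y j + y l < y j′ + y l′ → y′ j + y′ l < y′ j′ + y′ l′
    yy-order j l j′ l′ sum< = subst₂ _<_ (sym (y′+y′ j l)) (sym (y′+y′ j′ l′))
      (perturbed-< (weight j ℕ.+ weight l) (weight j′ ℕ.+ weight l′)
                   (∈-++⁺ʳ (sumsOf x y) (∈-sumsOf y y j l)) (∈-++⁺ʳ (sumsOf x y) (∈-sumsOf y y j′ l′)) sum<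
                   (weight+weight≤K j l))

    y′↑ : Increasing y → Increasing y′
    y′↑ y↑ j l j<l = +-mono-< (y↑ j l j<l) (·-monoˡ-< 0<ε (ℕₚ.^-monoʳ-< 2 (s≤s (s≤s z≤n)) j<l))

    equal-weights : ∀ {j l j′ l′} → y l + y j′ ≡ y j + y l′ → y′ l + y′ j′ ≡ y′ j + y′ l′ →
                    weight l ℕ.+ weight j′ ≡ weight j ℕ.+ weight l′
    equal-weights {j} {l} {j′} {l′} sums≡ sums′≡ = ·-cancelʳ 0<ε (+-cancelˡ (y l + y j′) _ _ (begin
      (y l + y j′) + (weight l ℕ.+ weight j′) · ε  ≡⟨ y′+y′ l j′ ⟨
      y′ l + y′ j′                                 ≡⟨ sums′≡ ⟩
      y′ j + y′ l′                                 ≡⟨ y′+y′ j l′ ⟩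
      (y j + y l′) + (weight j ℕ.+ weight l′) · ε  ≡⟨ cong (_+ (weight j ℕ.+ weight l′) · ε) sums≡ ⟨
      (y l + y j′) + (weight j ℕ.+ weight l′) · ε  ∎))
      where open ≡-Reasoning

    y′-distinctDifferences : DistinctDifferences y′
    y′-distinctDifferences {j} {l} {j′} {l′} j<l j′<l′ sums′≡ with <-cmp (y l + y j′) (y j + y l′)
    ... | tri< sum< _ _ = ⊥-elim (<-irrefl sums′≡ (yy-order l j′ j l′ sum<))
    ... | tri> _ _ sum> = ⊥-elim (<-irrefl (sym sums′≡) (yy-order j l′ l j′ sum>))
    ... | tri≈ _ sums≡ _ =
      let j≡j′ , l≡l′ = 2^-distinctDifferences j<l j′<l′ (equal-weights {j} {l} {j′} {l′} sums≡ sums′≡)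
      in toℕ-injective j≡j′ , toℕ-injective l≡l′

  -- The witness is y′_j = y_j + 2^j ε with 2^(n+1) ε below every gap between the sums x_i + y_j and y_j + y_l.
  perturb : ∀ {m n} {x : Fin m → ℚ} {y : Fin n → ℚ} → Admissible x y →
            Σ (Fin n → ℚ) λ y′ → Admissible x y′ × DistinctDifferences y′ × (∀ i j → rank x y′ i j ≡ rank x y i j)
  perturb {x = x} {y} (x↑ , y↑ , distinct) =
    y′ , (x↑ , y′↑ y↑ , DistinctSums-resp-< {x = x} {x} {y} {y′} distinct xy-order) , y′-distinctDifferences ,
    rank-cong-< {x = x} {x} {y} {y′} distinct xy-order
    where open Perturbation x y

module RowExtension where

  open import Defs
  open import Data.Nat as ℕ using (ℕ; suc; z≤n; s≤s; _<?_)
  import Data.Nat.Properties as ℕₚ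
  open import Data.Nat.Combinatorics using (_C_)
  open import Data.Fin as Fin using (Fin; zero; suc)
  open import Data.Vec using (tabulate)
  open import Data.Vec.Functional as Vector using ()
  open import Data.List using (List; _∷_; length; map; cartesianProduct; allFin)
  open import Data.List.Properties using (length-map; filter-≐)
  open import Data.List.Relation.Unary.Unique.Propositional using (Unique; _∷_)
  open import Data.List.Relation.Unary.All as All using ()
  open import Data.List.Relation.Unary.Any using (here; there)
  open import Data.List.Membership.Propositional using (_∈_)
  open import Data.List.Membership.Propositional.Properties using (∈-map⁺; ∈-map⁻; ∈-cartesianProduct⁺; ∈-allFin)
  open import Data.Product using (_×_; _,_; proj₁; proj₂; uncurry)
  open import Data.Empty using (⊥-elim)
  open import Data.Rational using (ℚ; _+_; _-_; -_; 0ℚ; _<_; _≤_)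
  open import Data.Rational.Properties using (+-0-group; <-irrefl; <⇒≤; ≤-refl; <-≤-trans; ≤-<-trans; <-cmp; +-comm)
  open import Data.Rational.Solver using (module +-*-Solver)
  open import Algebra.Properties.Group +-0-group using () renaming (∙-cancelˡ to +-cancelˡ)
  open import Relation.Binary using (tri<; tri≈; tri>)
  open import Relation.Binary.PropositionalEquality using (_≡_; _≢_; refl; sym; trans; cong; cong₂; subst)
  open Counting
  open Grids
  open Ranks
  open RationalGaps
  open GenericPosition

  restrict : ∀ {m n} → Tableau (suc m) n → Tableau m n
  restrict {m} {n} T = tabulate λ i → tabulate λ j →
    suc (count (λ p → entry T (suc (proj₁ p)) (proj₂ p) <? entry T (suc i) j) (grid m n))

  restrict-tableau : ∀ {m n} {a : ℚ} {x : Fin m → ℚ} {y : Fin n → ℚ} → DistinctSums (a Vector.∷ x) y →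
                     restrict (tableau (a Vector.∷ x) y) ≡ tableau x y
  restrict-tableau {m} {n} {a} {x} {y} distinct = Tableau-ext entries≡
    where
    open Relation.Binary.PropositionalEquality.≡-Reasoning
    X : Fin (suc m) → ℚ
    X = a Vector.∷ x
    T : Tableau (suc m) n
    T = tableau X y
    module _ (i : Fin m) (j : Fin n) where
      reflect : ∀ {p} → entry T (suc (proj₁ p)) (proj₂ p) ℕ.< entry T (suc i) j → x (proj₁ p) + y (proj₂ p) < x i + y j
      reflect {k , l} = tableau-cancel-< X y distinct (suc k) l (suc i) j
      preserve : ∀ {p} → x (proj₁ p) + y (proj₂ p) < x i + y j → entry T (suc (proj₁ p)) (proj₂ p) ℕ.< entry T (suc i) j
      preserve {k , l} = tableau-mono-< X y (suc k) l (suc i) j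
      entries≡ : entry (restrict T) i j ≡ entry (tableau x y) i j
      entries≡ = begin
        entry (restrict T) i j
          ≡⟨ entry-tabulate (λ i j → suc (count (λ p → entry T (suc (proj₁ p)) (proj₂ p) <? entry T (suc i) j) (grid m n)))
                            i j ⟩
        suc (count (λ p → entry T (suc (proj₁ p)) (proj₂ p) <? entry T (suc i) j) (grid m n))
          ≡⟨ cong (λ ps → suc (length ps)) (filter-≐ _ _ (reflect , preserve) (grid m n)) ⟩
        rank x y i j
          ≡⟨ entry-tableau x y i j ⟨
        entry (tableau x y) i j ∎

  module Extension {m n} (x : Fin (suc m) → ℚ) (y : Fin n → ℚ) (admissible : Admissible x y)
                   (distinctDifferences : DistinctDifferences y) where

    open +-*-Solver

    x↑ : Increasing x
    x↑ = proj₁ admissible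
    y↑ : Increasing y
    y↑ = proj₁ (proj₂ admissible)

    x₀ : ℚ
    x₀ = x zero

    critical : Fin (suc m) × Fin n × Fin n → ℚ
    critical (i , j , l) = (x₀ + y l) - (x i + y j)

    criticalValues : List ℚ
    criticalValues = 0ℚ ∷ map critical (cartesianProduct (allFin (suc m)) (grid n n))

    critical∈ : ∀ i j l → critical (i , j , l) ∈ criticalValues
    critical∈ i j l = there (∈-map⁺ critical (∈-cartesianProduct⁺ (∈-allFin i) (∈-grid (j , l))))

    η : ℚ
    η = proj₁ (uniformGap criticalValues)
    0<η : 0ℚ < η
    0<η = proj₁ (proj₂ (uniformGap criticalValues))
    gap : ∀ {a b} → a ∈ criticalValues → b ∈ criticalValues → a < b → a + η < b
    gap = proj₂ (proj₂ (uniformGap criticalValues))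

    shifted : ℚ → Fin (suc (suc m)) → ℚ
    shifted t = (x₀ - t) Vector.∷ x

    +η-avoids : ∀ {v u} → v ∈ criticalValues → u ∈ criticalValues → v + η ≢ u
    +η-avoids v∈ u∈ v+η≡u = <-irrefl v+η≡u (gap v∈ u∈ (subst (_ <_) v+η≡u (p<p+q 0<η)))

    sum≡⇒critical : ∀ {t k j l} → (x₀ - t) + y j ≡ x k + y l → t ≡ critical (k , l , j)
    sum≡⇒critical {t} {k} {j} {l} sum≡ = begin
      t                                  ≡⟨ solve 3 (λ a t b → t := (a :+ b) :- ((a :- t) :+ b)) refl x₀ t (y j) ⟩
      (x₀ + y j) - ((x₀ - t) + y j)      ≡⟨ cong (λ s → (x₀ + y j) - s) sum≡ ⟩
      (x₀ + y j) - (x k + y l)           ∎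
      where open Relation.Binary.PropositionalEquality.≡-Reasoning

    module _ {v} (v∈ : v ∈ criticalValues) (0≤v : 0ℚ ≤ v) where

      shifted↑ : Increasing (shifted (v + η))
      shifted↑ zero    (suc k) _         = <-≤-trans (p-q<p (<-≤-trans 0<η (p≤q+p 0≤v))) (x₀≤ k)
        where
        x₀≤ : ∀ k → x₀ ≤ x k
        x₀≤ zero    = ≤-refl
        x₀≤ (suc k) = <⇒≤ (x↑ zero (suc k) (s≤s z≤n))
      shifted↑ (suc i) (suc k) (s≤s i<k) = x↑ i k i<k

      shifted-distinct : DistinctSums (shifted (v + η)) y
      shifted-distinct zero    zero    j l sum≡ =
        refl , Increasing-injective y↑ (+-cancelˡ (x₀ - (v + η)) (y j) (y l) sum≡)
      shifted-distinct zero    (suc k) j l sum≡ = ⊥-elim (+η-avoids v∈ (critical∈ k l j) (sum≡⇒critical sum≡))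
      shifted-distinct (suc i) zero    j l sum≡ = ⊥-elim (+η-avoids v∈ (critical∈ i j l) (sum≡⇒critical (sym sum≡)))
      shifted-distinct (suc i) (suc k) j l sum≡ with refl , refl ← proj₂ (proj₂ admissible) i k j l sum≡ = refl , refl

      shifted-admissible : Admissible (shifted (v + η)) y
      shifted-admissible = shifted↑ , y↑ , shifted-distinct

    difference : Fin n × Fin n → ℚ
    difference (j , l) = y l - y j

    difference∈ : ∀ j l → difference (j , l) ∈ criticalValues
    difference∈ j l = subst (_∈ criticalValues) (solve 3 (λ a b c → (a :+ b) :- (a :+ c) := b :- c) refl x₀ (y l) (y j))
                            (critical∈ zero j l)

    positions : List ℚ
    positions = 0ℚ ∷ map difference (increasingPairs n)

    positions⊆critical : ∀ {v} → v ∈ positions → v ∈ criticalValues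
    positions⊆critical (here refl) = here refl
    positions⊆critical (there v∈) with ∈-map⁻ difference v∈
    ... | (j , l) , _ , refl = difference∈ j l

    0<difference : ∀ {p} → p ∈ increasingPairs n → 0ℚ < difference p
    0<difference {j , l} p∈ = 0<q-p (y↑ j l (increasingPairs-< n p∈))

    0≤position : ∀ {v} → v ∈ positions → 0ℚ ≤ v
    0≤position (here refl) = ≤-refl
    0≤position (there v∈) with ∈-map⁻ difference v∈
    ... | p , p∈ , refl = <⇒≤ (0<difference p∈)

    positions-unique : Unique positions
    positions-unique = All.tabulate 0≢difference ∷ map⁺-injectiveOn difference-injective (increasingPairs-unique n)
      where
      0≢difference : ∀ {v} → v ∈ map difference (increasingPairs n) → 0ℚ ≢ v
      0≢difference v∈ 0≡v with ∈-map⁻ difference v∈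
      ... | p , p∈ , refl = <-irrefl 0≡v (0<difference p∈)
      difference-injective : ∀ {p q} → p ∈ increasingPairs n → q ∈ increasingPairs n → difference p ≡ difference q → p ≡ q
      difference-injective {j , l} {j′ , l′} p∈ q∈ diff≡ = uncurry (cong₂ _,_)
        (distinctDifferences {j} {l} {j′} {l′} (increasingPairs-< n p∈) (increasingPairs-< n q∈)
          (trans (p-q≡r-s⇒p+s≡r+q {y l} {y j} {y l′} {y j′} diff≡) (+-comm (y l′) (y j))))

    length-positions : length positions ≡ suc (n C 2)
    length-positions = cong suc (trans (length-map difference (increasingPairs n)) (length-increasingPairs n))

    extension : ℚ → Tableau (suc (suc m)) n
    extension v = tableau (shifted (v + η)) y

    shifted+y≡ : ∀ t j l → shifted t zero + y l ≡ shifted t (suc zero) + y j + (difference (j , l) - t)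
    shifted+y≡ t j l = solve 4 (λ a t b c → (a :- t) :+ b := (a :+ c) :+ ((b :- c) :- t)) refl x₀ t (y l) (y j)

    -- Moving the shift across difference (j , l) swaps the order of the entries (0 , l) and (1 , j).
    extension-separates : ∀ {v v′} → v ∈ positions → v′ ∈ positions → v < v′ → extension v ≢ extension v′
    extension-separates v∈ (here refl) v<0 _ = <-irrefl refl (≤-<-trans (0≤position v∈) v<0)
    extension-separates {v} v∈ v′∈@(there d∈) v<d T≡T′ with ∈-map⁻ difference d∈
    ... | (j , l) , _ , refl = ℕₚ.<-asym before (subst (λ T → entry T zero l ℕ.< entry T (suc zero) j) (sym T≡T′) after)
      where
      D : ℚ
      D = difference (j , l)
      before : entry (extension v) (suc zero) j ℕ.< entry (extension v) zero l
      before = tableau-mono-< (shifted (v + η)) y (suc zero) j zero l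
        (subst (x₀ + y j <_) (sym (shifted+y≡ (v + η) j l))
          (p<p+q {x₀ + y j} (0<q-p {v + η} {D} (gap (positions⊆critical v∈) (positions⊆critical v′∈) v<d))))
      after : entry (extension D) zero l ℕ.< entry (extension D) (suc zero) j
      after = tableau-mono-< (shifted (D + η)) y zero l (suc zero) j
        (subst (_< x₀ + y j) (sym (shifted+y≡ (D + η) j l)) (p+q<p {x₀ + y j} (p-q<0 {D} {D + η} (p<p+q 0<η))))

    extension-injective : ∀ {v v′} → v ∈ positions → v′ ∈ positions → extension v ≡ extension v′ → v ≡ v′
    extension-injective {v} {v′} v∈ v′∈ T≡T′ with <-cmp v v′
    ... | tri< v<v′ _ _ = ⊥-elim (extension-separates v∈ v′∈ v<v′ T≡T′)
    ... | tri≈ _ v≡v′ _ = v≡v′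
    ... | tri> _ _ v>v′ = ⊥-elim (extension-separates v′∈ v∈ v>v′ (sym T≡T′))

    extensions : AtLeast (λ T → Realizable T × restrict T ≡ tableau x y) (suc (n C 2))
    extensions = map extension positions , map⁺-injectiveOn extension-injective positions-unique ,
                 trans (length-map extension positions) length-positions , extension-good
      where
      extension-good : ∀ {T} → T ∈ map extension positions → Realizable T × restrict T ≡ tableau x y
      extension-good T∈ with ∈-map⁻ extension {xs = positions} T∈
      ... | v , v∈ , refl = let admissible′ = shifted-admissible (positions⊆critical v∈) (0≤position v∈)
                            in tableau-realizable {x = shifted (v + η)} {y} admissible′ ,
                               restrict-tableau {a = x₀ - (v + η)} {x} {y} (proj₂ (proj₂ admissible′))

  extensionsOf : ∀ {m n} {T : Tableau (suc m) n} → Realizable T →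
                 AtLeast (λ T′ → Realizable T′ × restrict T′ ≡ T) (suc (n C 2))
  extensionsOf {T = T} (x , y , x↑ , y↑ , distinct , T≗rank) =
    let y′ , admissible′ , distinctDifferences′ , rank≡ = perturb {x = x} {y} (x↑ , y↑ , distinct)
        tableau≡T : tableau x y′ ≡ T
        tableau≡T = Tableau-ext λ i j → trans (entry-tableau x y′ i j) (trans (rank≡ i j) (sym (T≗rank i j)))
    in AtLeast-mono (λ (T′-real , restrict≡) → T′-real , trans restrict≡ tableau≡T)
                    (Extension.extensions x y′ admissible′ distinctDifferences′)

module Families where

  open import Defs
  open import Data.Nat using (ℕ; zero; suc; _*_; _≤_)
  open import Data.Nat.Combinatorics using (_C_)
  open import Data.Fin using (Fin; zero)
  open import Data.List using ([]; _∷_)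
  open import Data.List.Relation.Unary.Unique.Propositional using ([]; _∷_)
  open import Data.List.Relation.Unary.Any using (here)
  open import Data.List.Relation.Unary.All using ([])
  open import Data.Product using (_,_; proj₂)
  open import Data.Rational using (ℚ; 0ℚ)
  open import Relation.Binary.PropositionalEquality using (refl)
  open Counting
  open Ranks
  open RowExtension

  extendRows : ∀ {m n k} → AtLeast (Realizable {suc m} {n}) k → AtLeast (Realizable {suc (suc m)} {n}) (k * suc (n C 2))
  extendRows = AtLeast-fibres restrict extensionsOf

  transposeAll : ∀ {m n k} → AtLeast (Realizable {m} {n}) k → AtLeast (Realizable {n} {m}) k
  transposeAll = AtLeast-map transpose (λ {A} {B} → transpose-injective {A = A} {B})
                             (λ {T} → Realizable-transpose {T = T})

  squareFamilySize : ℕ → ℕ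
  squareFamilySize zero    = 1
  squareFamilySize (suc k) = squareFamilySize k * suc (suc k C 2) * suc (suc (suc k) C 2)

  squareFamily : ∀ k → AtLeast (Realizable {suc k} {suc k}) (squareFamilySize k)
  squareFamily zero    = tableau zeros zeros ∷ [] , [] ∷ [] , refl , λ { (here refl) → tableau-realizable admissible }
    where
    zeros : Fin 1 → ℚ
    zeros _ = 0ℚ
    admissible : Admissible zeros zeros
    admissible = (λ { zero zero () }) , (λ { zero zero () }) , λ { zero zero zero zero _ → refl , refl }
  squareFamily (suc k) = extendRows (transposeAll (extendRows (squareFamily k)))

  rowExtension-≤ : ∀ {m n a b} → HasSize (InRSYT (suc m) n) b → HasSize (InRSYT (suc (suc m)) n) a → b * suc (n C 2) ≤ a
  rowExtension-≤ hasSize-b hasSize-a =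
    AtLeast-≤-HasSize (extendRows (AtLeast-mono proj₂ (HasSize⇒AtLeast hasSize-b))) Realizable⇒InRSYT hasSize-a

  squareFamilySize-≤ : ∀ {k a} → HasSize (InRSYT (suc k) (suc k)) a → squareFamilySize k ≤ a
  squareFamilySize-≤ {k} = AtLeast-≤-HasSize (squareFamily k) Realizable⇒InRSYT

module Asymptotics where

  open import Data.Nat using (ℕ; zero; suc; _+_; _*_; _^_; _∸_; _≤_; _<_; z≤n; s≤s; _!; ⌊_/2⌋; ⌈_/2⌉; NonZero; >-nonZero)
  open import Data.Nat.Properties
  open import Data.Nat.Combinatorics using (_C_)
  open import Data.Nat.Induction using (<-rec)
  open import Data.Nat.Solver using (module +-*-Solver)
  open import Data.Product using (Σ; _,_)
  open import Relation.Binary.PropositionalEquality using (_≡_; refl; sym; trans; cong; cong₂; subst)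
  open Grids using ([1+n]C2≡n+nC2)
  open Families using (squareFamilySize)
  open +-*-Solver

  ^-distribʳ-* : ∀ a b k → (a * b) ^ k ≡ a ^ k * b ^ k
  ^-distribʳ-* a b zero    = refl
  ^-distribʳ-* a b (suc k) = trans (cong (a * b *_) (^-distribʳ-* a b k))
    (solve 4 (λ a b x y → (a :* b) :* (x :* y) := (a :* x) :* (b :* y)) refl a b (a ^ k) (b ^ k))

  ^-*-comm : ∀ a m k → (a ^ m) ^ k ≡ (a ^ k) ^ m
  ^-*-comm a m k = trans (^-*-assoc a m k) (trans (cong (a ^_) (*-comm m k)) (sym (^-*-assoc a k m)))

  q!*[1+q]^r≤[q+r]! : ∀ q r → q ! * suc q ^ r ≤ (q + r) !
  q!*[1+q]^r≤[q+r]! q zero    = ≤-reflexive (trans (*-identityʳ (q !)) (cong _! (sym (+-identityʳ q))))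
  q!*[1+q]^r≤[q+r]! q (suc r) = begin
    q ! * (suc q * suc q ^ r)  ≡⟨ solve 3 (λ a b c → a :* (b :* c) := b :* (a :* c)) refl (q !) (suc q) (suc q ^ r) ⟩
    suc q * (q ! * suc q ^ r)  ≤⟨ *-mono-≤ (s≤s (m≤m+n q r)) (q!*[1+q]^r≤[q+r]! q r) ⟩
    suc (q + r) * (q + r) !    ≡⟨ cong _! (+-suc q r) ⟨
    (q + suc r) !              ∎
    where open ≤-Reasoning

  2^[c+f]≤8^f : ∀ c f → c ≤ 2 * f → 2 ^ (c + f) ≤ 8 ^ f
  2^[c+f]≤8^f c f c≤2f = begin
    2 ^ (c + f)      ≤⟨ ^-monoʳ-≤ 2 (+-monoˡ-≤ f c≤2f) ⟩
    2 ^ (2 * f + f)  ≡⟨ cong (2 ^_) (solve 1 (λ f → con 2 :* f :+ f := con 3 :* f) refl f) ⟩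
    2 ^ (3 * f)      ≡⟨ ^-*-assoc 2 3 f ⟨
    8 ^ f            ∎
    where open ≤-Reasoning

  -- (c + f)^(c+f) ≤ 2^(c+f) c^c c^f, and c! (1+c)^f ≤ (c+f)! absorbs the factor c^f.
  n^n≤8^n*n!-step : ∀ c f → f ≤ c → c ≤ 2 * f → c ^ c ≤ 8 ^ c * c ! → (c + f) ^ (c + f) ≤ 8 ^ (c + f) * (c + f) !
  n^n≤8^n*n!-step c f f≤c c≤2f ih = begin
    (c + f) ^ (c + f)                    ≤⟨ ^-monoˡ-≤ (c + f) c+f≤2c ⟩
    (2 * c) ^ (c + f)                    ≡⟨ ^-distribʳ-* 2 c (c + f) ⟩
    2 ^ (c + f) * c ^ (c + f)            ≡⟨ cong (2 ^ (c + f) *_) (^-distribˡ-+-* c c f) ⟩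
    2 ^ (c + f) * (c ^ c * c ^ f)        ≤⟨ *-mono-≤ (2^[c+f]≤8^f c f c≤2f) (*-mono-≤ ih (^-monoˡ-≤ f (n≤1+n c))) ⟩
    8 ^ f * ((8 ^ c * c !) * suc c ^ f)  ≡⟨ rearrange (8 ^ f) (8 ^ c) (c !) (suc c ^ f) ⟩
    (8 ^ c * 8 ^ f) * (c ! * suc c ^ f)  ≤⟨ *-monoʳ-≤ (8 ^ c * 8 ^ f) (q!*[1+q]^r≤[q+r]! c f) ⟩
    (8 ^ c * 8 ^ f) * (c + f) !          ≡⟨ cong (_* (c + f) !) (^-distribˡ-+-* 8 c f) ⟨
    8 ^ (c + f) * (c + f) !              ∎
    where
    open ≤-Reasoning
    c+f≤2c : c + f ≤ 2 * c
    c+f≤2c = ≤-trans (+-monoʳ-≤ c f≤c) (≤-reflexive (solve 1 (λ c → c :+ c := con 2 :* c) refl c))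
    rearrange : ∀ a b x y → a * ((b * x) * y) ≡ (b * a) * (x * y)
    rearrange = solve 4 (λ a b x y → a :* ((b :* x) :* y) := (b :* a) :* (x :* y)) refl

  ⌈n/2⌉≤1+⌊n/2⌋ : ∀ n → ⌈ n /2⌉ ≤ suc ⌊ n /2⌋
  ⌈n/2⌉≤1+⌊n/2⌋ zero          = z≤n
  ⌈n/2⌉≤1+⌊n/2⌋ (suc zero)    = s≤s z≤n
  ⌈n/2⌉≤1+⌊n/2⌋ (suc (suc n)) = s≤s (⌈n/2⌉≤1+⌊n/2⌋ n)

  1+n≤2*n : ∀ {n} → 1 ≤ n → suc n ≤ 2 * n
  1+n≤2*n {n} 1≤n = begin
    suc n  ≡⟨ +-comm 1 n ⟩
    n + 1  ≤⟨ +-monoʳ-≤ n 1≤n ⟩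
    n + n  ≡⟨ solve 1 (λ n → n :+ n := con 2 :* n) refl n ⟩
    2 * n  ∎
    where open ≤-Reasoning

  n^n≤8^n*n! : ∀ n → n ^ n ≤ 8 ^ n * n !
  n^n≤8^n*n! = <-rec (λ n → n ^ n ≤ 8 ^ n * n !) step
    where
    step : ∀ n → (∀ {m} → m < n → m ^ m ≤ 8 ^ m * m !) → n ^ n ≤ 8 ^ n * n !
    step zero          _  = s≤s z≤n
    step (suc zero)    _  = s≤s z≤n
    step n@(suc (suc k)) ih = subst (λ n → n ^ n ≤ 8 ^ n * n !) (trans (+-comm ⌈ n /2⌉ ⌊ n /2⌋) (⌊n/2⌋+⌈n/2⌉≡n n))
      (n^n≤8^n*n!-step ⌈ n /2⌉ ⌊ n /2⌋ (⌊n/2⌋≤⌈n/2⌉ n) (≤-trans (⌈n/2⌉≤1+⌊n/2⌋ n) (1+n≤2*n (s≤s z≤n)))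
                       (ih (⌈n/2⌉<n k)))

  2*[[1+n]C2]≡[1+n]*n : ∀ n → 2 * (suc n C 2) ≡ suc n * n
  2*[[1+n]C2]≡[1+n]*n zero    = refl
  2*[[1+n]C2]≡[1+n]*n (suc n) = begin
    2 * (suc (suc n) C 2)        ≡⟨ cong (2 *_) ([1+n]C2≡n+nC2 (suc n)) ⟩
    2 * (suc n + suc n C 2)      ≡⟨ *-distribˡ-+ 2 (suc n) (suc n C 2) ⟩
    2 * suc n + 2 * (suc n C 2)  ≡⟨ cong (2 * suc n +_) (2*[[1+n]C2]≡[1+n]*n n) ⟩
    2 * suc n + suc n * n        ≡⟨ solve 1 (λ n → con 2 :* (con 1 :+ n) :+ (con 1 :+ n) :* n
                                                 := (con 2 :+ n) :* (con 1 :+ n)) refl n ⟩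
    suc (suc n) * suc n          ∎
    where open Relation.Binary.PropositionalEquality.≡-Reasoning

  n*n≤4*[1+nC2] : ∀ n → n * n ≤ 4 * suc (n C 2)
  n*n≤4*[1+nC2] zero    = z≤n
  n*n≤4*[1+nC2] (suc n) = begin
    suc n * suc n                ≤⟨ m≤m+n (suc n * suc n) (n * n + 3) ⟩
    suc n * suc n + (n * n + 3)  ≡⟨ solve 1 (λ n → (con 1 :+ n) :* (con 1 :+ n) :+ (n :* n :+ con 3)
                                                 := con 4 :+ con 2 :* ((con 1 :+ n) :* n)) refl n ⟩
    4 + 2 * (suc n * n)          ≡⟨ cong (λ c → 4 + 2 * c) (2*[[1+n]C2]≡[1+n]*n n) ⟨
    4 + 2 * (2 * (suc n C 2))    ≡⟨ solve 1 (λ c → con 4 :+ con 2 :* (con 2 :* c) := con 4 :* (con 1 :+ c))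
                                          refl (suc n C 2) ⟩
    4 * suc (suc n C 2)          ∎
    where open ≤-Reasoning

  -- Each step multiplies squareFamilySize by (1 + C(n,2)) (1 + C(n+1,2)) ≥ n² (n+1)² / 16.
  [1+k]!^4≤squareFamilySize : ∀ k → (suc k !) ^ 4 ≤ 16 ^ suc k * (suc k * suc k) * squareFamilySize k
  [1+k]!^4≤squareFamilySize zero    = s≤s z≤n
  [1+k]!^4≤squareFamilySize (suc k) = begin
    (n′ * n !) ^ 4                                    ≡⟨ ^-distribʳ-* n′ (n !) 4 ⟩
    n′ ^ 4 * (n !) ^ 4                                ≤⟨ *-monoʳ-≤ (n′ ^ 4) ([1+k]!^4≤squareFamilySize k) ⟩
    n′ ^ 4 * (16 ^ n * (n * n) * g)                   ≡⟨ regroup n′ (16 ^ n) n g ⟩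
    (16 ^ n * (n′ * n′) * g) * ((n * n) * (n′ * n′))  ≤⟨ *-monoʳ-≤ (16 ^ n * (n′ * n′) * g)
                                                           (*-mono-≤ (n*n≤4*[1+nC2] n) (n*n≤4*[1+nC2] n′)) ⟩
    (16 ^ n * (n′ * n′) * g) * ((4 * a) * (4 * b))    ≡⟨ collect (16 ^ n) n′ g a b ⟩
    16 ^ n′ * (n′ * n′) * (g * a * b)                 ∎
    where
    open ≤-Reasoning
    n : ℕ
    n = suc k
    n′ : ℕ
    n′ = suc n
    g : ℕ
    g = squareFamilySize k
    a : ℕ
    a = suc (n C 2)
    b : ℕ
    b = suc (n′ C 2)
    regroup : ∀ x p m h → x ^ 4 * (p * (m * m) * h) ≡ (p * (x * x) * h) * ((m * m) * (x * x))
    regroup = solve 4 (λ x p m h → (x :^ 4) :* (p :* (m :* m) :* h)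
                                   := (p :* (x :* x) :* h) :* ((m :* m) :* (x :* x))) refl
    collect : ∀ p x h a b → (p * (x * x) * h) * ((4 * a) * (4 * b)) ≡ (16 * p) * (x * x) * (h * a * b)
    collect = solve 5 (λ p x h a b → (p :* (x :* x) :* h) :* ((con 4 :* a) :* (con 4 :* b))
                                     := (con 16 :* p) :* (x :* x) :* (h :* a :* b)) refl

  [n^n]^4≤c^n*n²*squareFamilySize : ∀ k →
    (suc k ^ suc k) ^ 4 ≤ (8 ^ 4 * 16) ^ suc k * (suc k * suc k) * squareFamilySize k
  [n^n]^4≤c^n*n²*squareFamilySize k = begin
    (n ^ n) ^ 4                            ≤⟨ ^-monoˡ-≤ 4 (n^n≤8^n*n! n) ⟩
    (8 ^ n * n !) ^ 4                      ≡⟨ ^-distribʳ-* (8 ^ n) (n !) 4 ⟩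
    (8 ^ n) ^ 4 * (n !) ^ 4                ≤⟨ *-monoʳ-≤ ((8 ^ n) ^ 4) ([1+k]!^4≤squareFamilySize k) ⟩
    (8 ^ n) ^ 4 * (16 ^ n * (n * n) * g)   ≡⟨ solve 4 (λ e s m h → e :* (s :* m :* h) := (e :* s) :* m :* h) refl
                                                      ((8 ^ n) ^ 4) (16 ^ n) (n * n) g ⟩
    (8 ^ n) ^ 4 * 16 ^ n * (n * n) * g     ≡⟨ cong (λ z → z * 16 ^ n * (n * n) * g) (^-*-comm 8 n 4) ⟩
    (8 ^ 4) ^ n * 16 ^ n * (n * n) * g     ≡⟨ cong (λ z → z * (n * n) * g) (^-distribʳ-* (8 ^ 4) 16 n) ⟨
    (8 ^ 4 * 16) ^ n * (n * n) * g         ∎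
    where
    open ≤-Reasoning
    n : ℕ
    n = suc k
    g : ℕ
    g = squareFamilySize k

  B^[k+h]*[k+h]^k≤[k+h]^[k+h] : ∀ B k h → 1 ≤ B → k ≤ h → B * B ≤ k + h →
                                B ^ (k + h) * (k + h) ^ k ≤ (k + h) ^ (k + h)
  B^[k+h]*[k+h]^k≤[k+h]^[k+h] B k h 1≤B k≤h B²≤n = begin
    B ^ (k + h) * n ^ k        ≡⟨ cong (_* n ^ k) (^-distribˡ-+-* B k h) ⟩
    (B ^ k * B ^ h) * n ^ k    ≤⟨ *-monoˡ-≤ (n ^ k) (*-monoˡ-≤ (B ^ h) (^-monoʳ-≤ B {{>-nonZero 1≤B}} k≤h)) ⟩
    (B ^ h * B ^ h) * n ^ k    ≡⟨ cong (_* n ^ k) (^-distribʳ-* B B h) ⟨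
    (B * B) ^ h * n ^ k        ≤⟨ *-monoˡ-≤ (n ^ k) (^-monoˡ-≤ h B²≤n) ⟩
    n ^ h * n ^ k              ≡⟨ ^-distribˡ-+-* n h k ⟨
    n ^ (h + k)                ≡⟨ cong (n ^_) (+-comm h k) ⟩
    n ^ n                      ∎
    where
    open ≤-Reasoning
    n : ℕ
    n = k + h

  B^n*n^[2K]≤n^n : ∀ B K n → 1 ≤ B → B * B + 4 * K ≤ n → B ^ n * n ^ (2 * K) ≤ n ^ n
  B^n*n^[2K]≤n^n B K n 1≤B B²+4K≤n = subst (λ n → B ^ n * n ^ (2 * K) ≤ n ^ n) 2K+h≡n
    (B^[k+h]*[k+h]^k≤[k+h]^[k+h] B (2 * K) h 1≤B 2K≤h (subst (B * B ≤_) (sym 2K+h≡n) B²≤n))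
    where
    h : ℕ
    h = n ∸ 2 * K
    B²≤n : B * B ≤ n
    B²≤n = ≤-trans (m≤m+n (B * B) (4 * K)) B²+4K≤n
    2K+2K≤n : 2 * K + 2 * K ≤ n
    2K+2K≤n = subst (_≤ n) (solve 1 (λ k → con 4 :* k := con 2 :* k :+ con 2 :* k) refl K)
                    (≤-trans (m≤n+m (4 * K) (B * B)) B²+4K≤n)
    2K+h≡n : 2 * K + h ≡ n
    2K+h≡n = m+[n∸m]≡n (≤-trans (m≤m+n (2 * K) (2 * K)) 2K+2K≤n)
    2K≤h : 2 * K ≤ h
    2K≤h = +-cancelˡ-≤ (2 * K) (2 * K) h (subst (2 * K + 2 * K ≤_) (sym 2K+h≡n) 2K+2K≤n)

  [cⁿn²]^K≤nⁿ : ∀ c K n → 1 ≤ c → c ^ K * c ^ K + 4 * K ≤ n → (c ^ n * (n * n)) ^ K ≤ n ^ n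
  [cⁿn²]^K≤nⁿ c K n 1≤c bound = begin
    (c ^ n * (n * n)) ^ K      ≡⟨ ^-distribʳ-* (c ^ n) (n * n) K ⟩
    (c ^ n) ^ K * (n * n) ^ K  ≡⟨ cong₂ _*_ (^-*-comm c n K) [n*n]^K≡n^[2*K] ⟩
    (c ^ K) ^ n * n ^ (2 * K)  ≤⟨ B^n*n^[2K]≤n^n (c ^ K) K n (m^n>0 c {{>-nonZero 1≤c}} K) bound ⟩
    n ^ n                      ∎
    where
    open ≤-Reasoning
    [n*n]^K≡n^[2*K] : (n * n) ^ K ≡ n ^ (2 * K)
    [n*n]^K≡n^[2*K] = trans (cong (λ m → (n * m) ^ K) (sym (*-identityʳ n))) (^-*-assoc n 2 K)

  [m∸1]*n+n≡n*m : ∀ {m} n → 1 ≤ m → (m ∸ 1) * n + n ≡ n * m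
  [m∸1]*n+n≡n*m {m} n 1≤m = begin
    (m ∸ 1) * n + n      ≡⟨ cong ((m ∸ 1) * n +_) (*-identityˡ n) ⟨
    (m ∸ 1) * n + 1 * n  ≡⟨ *-distribʳ-+ n (m ∸ 1) 1 ⟨
    (m ∸ 1 + 1) * n      ≡⟨ cong (_* n) (m∸n+n≡m 1≤m) ⟩
    m * n                ≡⟨ *-comm m n ⟩
    n * m                ∎
    where open Relation.Binary.PropositionalEquality.≡-Reasoning

  -- With P = n^n:  n^((4K-1)n) P = (P^4)^K ≤ (c^n n²)^K g^K ≤ P g^K, and P cancels.
  squareFamilySize-growth : ∀ K → 1 ≤ K → Σ ℕ λ N → ∀ k → N ≤ k → ∀ a → squareFamilySize k ≤ a →
                            suc k ^ ((4 * K ∸ 1) * suc k) ≤ a ^ K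
  squareFamilySize-growth K 1≤K = c ^ K * c ^ K + 4 * K , bound
    where
    c : ℕ
    c = 8 ^ 4 * 16
    bound : ∀ k → c ^ K * c ^ K + 4 * K ≤ k → ∀ a → squareFamilySize k ≤ a → suc k ^ ((4 * K ∸ 1) * suc k) ≤ a ^ K
    bound k N≤k a g≤a = *-cancelˡ-≤ P (begin
      P * n ^ ((4 * K ∸ 1) * n)      ≡⟨ *-comm P (n ^ ((4 * K ∸ 1) * n)) ⟩
      n ^ ((4 * K ∸ 1) * n) * P      ≡⟨ ^-distribˡ-+-* n ((4 * K ∸ 1) * n) n ⟨
      n ^ ((4 * K ∸ 1) * n + n)      ≡⟨ cong (n ^_) ([m∸1]*n+n≡n*m n (≤-trans 1≤K (m≤n*m K 4))) ⟩
      n ^ (n * (4 * K))              ≡⟨ ^-*-assoc n n (4 * K) ⟨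
      P ^ (4 * K)                    ≡⟨ ^-*-assoc P 4 K ⟨
      (P ^ 4) ^ K                    ≤⟨ ^-monoˡ-≤ K ([n^n]^4≤c^n*n²*squareFamilySize k) ⟩
      (c ^ n * (n * n) * g) ^ K      ≡⟨ ^-distribʳ-* (c ^ n * (n * n)) g K ⟩
      (c ^ n * (n * n)) ^ K * g ^ K  ≤⟨ *-mono-≤ ([cⁿn²]^K≤nⁿ c K n (s≤s z≤n) (≤-trans N≤k (n≤1+n k)))
                                                 (^-monoˡ-≤ K g≤a) ⟩
      P * a ^ K                      ∎)
      where
      open ≤-Reasoning
      n : ℕ
      n = suc k
      P : ℕ
      P = n ^ n
      g : ℕ
      g = squareFamilySize k
      instance
        P≢0 : NonZero P
        P≢0 = m^n≢0 n n

open import Defs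
open import Data.Nat using (ℕ; _≤_; _*_; _+_; _∸_; _^_; suc; s≤s; z≤n)
open import Data.Nat.Combinatorics using (_C_)
open import Data.Product using (Σ; _×_; _,_)
open import Data.Nat.Properties using (+-comm)
open import Relation.Binary.PropositionalEquality using (subst)
open Families
open Asymptotics

theorem1p3 : ((m n : ℕ) → 2 ≤ m → 1 ≤ n → (a b : ℕ) →
    HasSize (InRSYT m n) a → HasSize (InRSYT (m ∸ 1) n) b →
    b * ((n C 2) + 1) ≤ a)
    ×
    ((k : ℕ) → 1 ≤ k → Σ ℕ λ N → (n : ℕ) → N ≤ n → (a : ℕ) →
    HasSize (InRSYT n n) a → n ^ (((4 * k) ∸ 1) * n) ≤ a ^ k)
theorem1p3 = rowBound , squareBound
  where
  -- The row extension argument also works for n = 0.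
  rowBound : (m n : ℕ) → 2 ≤ m → 1 ≤ n → (a b : ℕ) →
             HasSize (InRSYT m n) a → HasSize (InRSYT (m ∸ 1) n) b → b * ((n C 2) + 1) ≤ a
  rowBound (suc (suc m)) n (s≤s (s≤s z≤n)) _ a b hasSize-a hasSize-b =
    subst (λ c → b * c ≤ a) (+-comm 1 (n C 2)) (rowExtension-≤ hasSize-b hasSize-a)
  squareBound : (k : ℕ) → 1 ≤ k → Σ ℕ λ N → (n : ℕ) → N ≤ n → (a : ℕ) →
                HasSize (InRSYT n n) a → n ^ (((4 * k) ∸ 1) * n) ≤ a ^ k
  squareBound k 1≤k =
    let N , growth = squareFamilySize-growth k 1≤k
    in suc N , λ { (suc n) (s≤s N≤n) a hasSize-a → growth n N≤n a (squareFamilySize-≤ hasSize-a) }
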